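{- Let $m,n$ be positive integers, let $\mathcal{A}\subseteq \mathbb{Z}/m\mathbb{Z}$ and $\mathcal{B}\subseteq\mathbb{Z}/n\mathbb{Z}$ be collections of residue classes modulo $m$ and $n$, respectively, and let $g=\gcd(m,n)$. Let $h$ denote the number of solutions modulo $mn/g$ of the linear system \[ x\equiv a \pmod m,\qquad x\equiv b\pmod n \] as $(a,b)$ ranges over $\mathcal{A}\times\mathcal{B}$, i.e. $h$ is the number of residue classes $x$ modulo $mn/g$ such that $x \bmod m\in\mathcal{A}$ and $x\bmod n\in\mathcal{B}$. Write \[ |\mathcal{A}|=A\frac{m}{g}+r_A,\quad 0\le r_A<\frac{m}{g},\qquad |\mathcal{B}|=B\frac{n}{g}+r_B,\quad 0\le r_B<\frac{n}{g}, \] with $A,B$ non-negative integers. Then \[ h\ge\begin{cases}0,&\text{if } A+B<g-1,\\ r_Ar_B,&\text{if } A+B=g-1,\\ (A+B-g)\dfrac{mn}{g^2}+r_A\dfrac{n}{g}+r_B\dfrac{m}{g},&\text{if } A+B>g-1.\end{cases} \]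
   Context: Here $\mathcal{A}$ and $\mathcal{B}$ are arbitrary sets of residue classes (not necessarily intervals), and $A,B$ denote the integer quotients defined in the claim (distinct from the sets $\mathcal{A},\mathcal{B}$). -}

module Defs where

open import Data.Nat using (ℕ; suc; _*_)
open import Data.Nat.DivMod using (_mod_)
open import Data.Fin using (Fin; toℕ)
open import Data.Fin.Subset using (Subset; _∈_; ∣_∣)
open import Data.Fin.Subset.Properties using (_∈?_)
open import Data.Vec using (tabulate)
open import Relation.Nullary using (_×-dec_; does)
open import Data.Bool using (if_then_else_)
open import Data.Fin.Subset using (inside; outside)

-- h : the number of residues x modulo L (L = mn/g, passed explicitly)
-- with (x mod m) ∈ 𝒜 and (x mod n) ∈ ℬ.  Here m = suc m₀, n = suc n₀.
solSet : (m₀ n₀ L : ℕ) → Subset (suc m₀) → Subset (suc n₀) → Subset L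
solSet m₀ n₀ L 𝒜 ℬ = tabulate λ x →
  if does (((toℕ x mod suc m₀) ∈? 𝒜) ×-dec ((toℕ x mod suc n₀) ∈? ℬ))
  then inside else outside

h : (m₀ n₀ L : ℕ) → Subset (suc m₀) → Subset (suc n₀) → ℕ
h m₀ n₀ L 𝒜 ℬ = ∣ solSet m₀ n₀ L 𝒜 ℬ ∣

module Submission where

open import Defs
open import Data.Nat using (ℕ; suc; _+_; _*_; _∸_; _<_; _≤_)
open import Data.Nat.GCD using (gcd)
open import Data.Fin.Subset using (Subset; ∣_∣)
open import Relation.Binary.PropositionalEquality using (_≡_)
open import Data.Product using (_×_)

-- Write m = m'g, n = n'g, so m' and n' are coprime and L = mn/g = m'n'g.  Every
-- residue modulo L is y·g + c with c < g; let α c (resp. β c) count the elements of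
-- 𝒜 (resp. ℬ) congruent to c modulo g.  On each class c the conditions on y are
-- m'- resp. n'-periodic, so the Chinese remainder theorem gives
--        h = Σ_c α c · β c,   |𝒜| = Σ_c α c,   |ℬ| = Σ_c β c,   α c ≤ m',  β c ≤ n'.
-- The theorem thus reduces to inequalities for two bounded sequences of length g:
--  * if A + B ≥ g, sum (m' − α c)(n' − β c) ≥ 0 over c;
--  * if A + B + 1 = g, sum r·β ≤ α·β + n'(r ∸ α) (r = rA) and use the deficit
--    bound Σ_c (r ∸ α c) ≤ B·r, which holds because Σ α = A·m' + r.

open import Data.Nat using (zero; z≤n; s≤s; NonZero; _%_; _/_; _<?_; _≤?_)
open import Data.Nat.Properties
open import Data.Nat.DivMod using (_mod_; m≡m%n+[m/n]*n; [m+kn]%n≡m%n; m<n⇒m%n≡m)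
open import Data.Nat.Divisibility using (_∣_; divides; n∣m*n; ∣m+n∣m⇒∣n; ∣⇒≤)
open import Data.Nat.GCD using (GCD; gcd-GCD; GCD-*)
open import Data.Nat.Coprimality using (Coprime; coprime-divisor; GCD≡1⇒coprime)
open import Data.Nat.Tactic.RingSolver using (solve-∀)
open import Data.Bool using (Bool; true; false; if_then_else_; _∧_)
open import Data.Fin using (Fin; toℕ; punchOut) renaming (zero to fzero; suc to fsuc)
open import Data.Fin.Properties
  using (toℕ<n; toℕ-fromℕ<; toℕ-injective; any?; punchOut-injective; injective⇒≤)
  renaming (_≟_ to _≟ᶠ_)
open import Data.Fin.Permutation using (Permutation; permutation)
open import Data.Fin.Subset using (inside; outside)
open import Data.Fin.Subset.Properties using (_∈?_)
open import Data.Vec using (tabulate; lookup; _∷_)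
open import Data.Vec.Properties using (tabulate∘lookup; tabulate-cong)
open import Algebra.Properties.Semiring.Sum +-*-semiring
  using (sum; sum-cong-≗; ∑-distrib-+; ∑-comm; ∑-permute; *-distribˡ-sum; *-distribʳ-sum)
open import Function.Definitions using (Injective)
open import Data.Product using (_,_; proj₁; proj₂; ∃)
open import Data.Sum using (inj₁; inj₂)
open import Data.Empty using (⊥-elim)
open import Relation.Nullary using (yes; no; does; _×-dec_)
open import Relation.Binary.PropositionalEquality
  using (refl; sym; trans; cong; cong₂; subst; subst₂; _≢_; module ≡-Reasoning)

-- Finite sums over initial segments of ℕ

-- sumTo N f = f 0 + f 1 + ⋯ + f (N − 1); it unfolds definitionally as
-- sumTo (suc N) f = f 0 + sumTo N (λ i → f (suc i)).
sumTo : ℕ → (ℕ → ℕ) → ℕ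
sumTo N f = sum {N} (λ i → f (toℕ i))

sumTo-cong : ∀ N {f g : ℕ → ℕ} → (∀ i → i < N → f i ≡ g i) → sumTo N f ≡ sumTo N g
sumTo-cong N f≡g = sum-cong-≗ (λ i → f≡g (toℕ i) (toℕ<n i))

sumTo-mono : ∀ N {f g : ℕ → ℕ} → (∀ i → i < N → f i ≤ g i) → sumTo N f ≤ sumTo N g
sumTo-mono zero    _   = z≤n
sumTo-mono (suc N) f≤g = +-mono-≤ (f≤g 0 (s≤s z≤n)) (sumTo-mono N (λ i i<N → f≤g (suc i) (s≤s i<N)))

sumTo-const : ∀ N k → sumTo N (λ _ → k) ≡ N * k
sumTo-const zero    k = refl
sumTo-const (suc N) k = cong (k +_) (sumTo-const N k)

sumTo-+ : ∀ N (f g : ℕ → ℕ) → sumTo N (λ i → f i + g i) ≡ sumTo N f + sumTo N g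
sumTo-+ N f g = ∑-distrib-+ {N} (λ i → f (toℕ i)) (λ i → g (toℕ i))

sumTo-*ˡ : ∀ N k (f : ℕ → ℕ) → sumTo N (λ i → k * f i) ≡ k * sumTo N f
sumTo-*ˡ N k f = sym (*-distribˡ-sum {N} k (λ i → f (toℕ i)))

sumTo-*ʳ : ∀ N k (f : ℕ → ℕ) → sumTo N (λ i → f i * k) ≡ sumTo N f * k
sumTo-*ʳ N k f = sym (*-distribʳ-sum {N} k (λ i → f (toℕ i)))

sumTo-split : ∀ a b (f : ℕ → ℕ) → sumTo (a + b) f ≡ sumTo a f + sumTo b (λ i → f (a + i))
sumTo-split zero    b f = refl
sumTo-split (suc a) b f =
  trans (cong (f 0 +_) (sumTo-split a b (λ i → f (suc i))))
        (sym (+-assoc (f 0) (sumTo a (λ i → f (suc i))) _))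

sumTo-blocks : ∀ K g (f : ℕ → ℕ) →
  sumTo (K * g) f ≡ sumTo K (λ y → sumTo g (λ c → f (y * g + c)))
sumTo-blocks zero    g f = refl
sumTo-blocks (suc K) g f = begin
  sumTo (g + K * g) f                                          ≡⟨ sumTo-split g (K * g) f ⟩
  sumTo g f + sumTo (K * g) (λ i → f (g + i))                   ≡⟨ cong (sumTo g f +_) (sumTo-blocks K g (λ i → f (g + i))) ⟩
  sumTo g f + sumTo K (λ y → sumTo g (λ c → f (g + (y * g + c))))
    ≡⟨ cong (sumTo g f +_) (sumTo-cong K (λ y _ → sumTo-cong g (λ c _ → cong f (sym (+-assoc g (y * g) c))))) ⟩
  sumTo g f + sumTo K (λ y → sumTo g (λ c → f (suc y * g + c))) ∎
  where open ≡-Reasoning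

sumTo-byResidue : ∀ K g (f : ℕ → ℕ) →
  sumTo (K * g) f ≡ sumTo g (λ c → sumTo K (λ y → f (y * g + c)))
sumTo-byResidue K g f =
  trans (sumTo-blocks K g f) (∑-comm {K} {g} (λ y c → f (toℕ y * g + toℕ c)))

-- Counting subsets of residues as sums of indicators

ind : Bool → ℕ
ind b = if b then 1 else 0

ind≤1 : ∀ b → ind b ≤ 1
ind≤1 true  = s≤s z≤n
ind≤1 false = z≤n

χ : ∀ {N} .{{_ : NonZero N}} → Subset N → ℕ → ℕ
χ {N} 𝒜 k = ind (does ((k mod N) ∈? 𝒜))

count-tabulate : ∀ N (b : ℕ → Bool) →
  ∣ tabulate {n = N} (λ x → if b (toℕ x) then inside else outside) ∣ ≡ sumTo N (λ k → ind (b k))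
count-tabulate zero    b = refl
count-tabulate (suc N) b with b 0
... | true  = cong suc (count-tabulate N (λ k → b (suc k)))
... | false = count-tabulate N (λ k → b (suc k))

lookup-∈? : ∀ {N} (𝒜 : Subset N) (x : Fin N) →
  (if does (x ∈? 𝒜) then inside else outside) ≡ lookup 𝒜 x
lookup-∈? (true  ∷ 𝒜) fzero    = refl
lookup-∈? (false ∷ 𝒜) fzero    = refl
lookup-∈? (_     ∷ 𝒜) (fsuc x) = lookup-∈? 𝒜 x

toℕ-mod : ∀ {N} .{{_ : NonZero N}} (x : Fin N) → toℕ x mod N ≡ x
toℕ-mod x = toℕ-injective (trans (toℕ-fromℕ< _) (m<n⇒m%n≡m (toℕ<n x)))

size-sumTo : ∀ N .{{_ : NonZero N}} (𝒜 : Subset N) → ∣ 𝒜 ∣ ≡ sumTo N (χ 𝒜)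
size-sumTo N 𝒜 = begin
  ∣ 𝒜 ∣                    ≡⟨ cong ∣_∣ (sym (tabulate∘lookup 𝒜)) ⟩
  ∣ tabulate (lookup 𝒜) ∣  ≡⟨ cong ∣_∣ (tabulate-cong entry) ⟩
  ∣ tabulate {n = N} (λ x → if does ((toℕ x mod N) ∈? 𝒜) then inside else outside) ∣
                           ≡⟨ count-tabulate N (λ k → does ((k mod N) ∈? 𝒜)) ⟩
  sumTo N (χ 𝒜)            ∎
  where
  open ≡-Reasoning
  entry : ∀ x → lookup 𝒜 x ≡ (if does ((toℕ x mod N) ∈? 𝒜) then inside else outside)
  entry x = sym (trans (cong (λ y → if does (y ∈? 𝒜) then inside else outside) (toℕ-mod x))
                       (lookup-∈? 𝒜 x))

h-sumTo : ∀ m₀ n₀ L (𝒜 : Subset (suc m₀)) (ℬ : Subset (suc n₀)) →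
  h m₀ n₀ L 𝒜 ℬ ≡ sumTo L (λ k → χ 𝒜 k * χ ℬ k)
h-sumTo m₀ n₀ L 𝒜 ℬ =
  trans (count-tabulate L (λ k → does (((k mod suc m₀) ∈? 𝒜) ×-dec ((k mod suc n₀) ∈? ℬ))))
        (sumTo-cong L (λ k _ → ind-∧ (does ((k mod suc m₀) ∈? 𝒜)) (does ((k mod suc n₀) ∈? ℬ))))
  where
  ind-∧ : ∀ a b → ind (a ∧ b) ≡ ind a * ind b
  ind-∧ true  true  = refl
  ind-∧ true  false = refl
  ind-∧ false _     = refl

-- Periodic functions and the Chinese remainder product formula

Periodic : ℕ → (ℕ → ℕ) → Set
Periodic N f = ∀ x q → f (x + q * N) ≡ f x

periodic-mod : ∀ {N} .{{_ : NonZero N}} {f : ℕ → ℕ} → Periodic N f → ∀ x → f x ≡ f (x % N)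
periodic-mod {N} {f} per x = trans (cong f (m≡m%n+[m/n]*n x N)) (per (x % N) (x / N))

χ-periodic : ∀ {N} .{{_ : NonZero N}} (𝒜 : Subset N) → Periodic N (χ 𝒜)
χ-periodic {N} 𝒜 x q =
  cong (λ r → ind (does (r ∈? 𝒜))) (toℕ-injective (begin
    toℕ ((x + q * N) mod N)  ≡⟨ toℕ-fromℕ< _ ⟩
    (x + q * N) % N          ≡⟨ [m+kn]%n≡m%n x q N ⟩
    x % N                    ≡⟨ toℕ-fromℕ< _ ⟨
    toℕ (x mod N)            ∎))
  where open ≡-Reasoning

class-periodic : ∀ m' g {f : ℕ → ℕ} → Periodic (m' * g) f → ∀ c →
  Periodic m' (λ y → f (y * g + c))
class-periodic m' g {f} per c y q = trans (cong f (regroup y q m' g c)) (per (y * g + c) q)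
  where
  regroup : ∀ y q m' g c → (y + q * m') * g + c ≡ y * g + c + q * (m' * g)
  regroup = solve-∀

same-residue⇒∣ : ∀ k .{{_ : NonZero k}} X Y → X % k ≡ (X + Y) % k → k ∣ Y
same-residue⇒∣ k X Y eq = ∣m+n∣m⇒∣n (divides ((X + Y) / k) (+-cancelˡ-≡ (X % k) _ _ both)) (n∣m*n (X / k))
  where
  open ≡-Reasoning
  both : X % k + ((X / k) * k + Y) ≡ X % k + ((X + Y) / k) * k
  both = begin
    X % k + ((X / k) * k + Y)       ≡⟨ +-assoc (X % k) _ Y ⟨
    (X % k + (X / k) * k) + Y       ≡⟨ cong (_+ Y) (m≡m%n+[m/n]*n X k) ⟨
    X + Y                           ≡⟨ m≡m%n+[m/n]*n (X + Y) k ⟩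
    (X + Y) % k + ((X + Y) / k) * k ≡⟨ cong (_+ ((X + Y) / k) * k) eq ⟨
    X % k + ((X + Y) / k) * k       ∎

-- Multiplying by n' and shifting by j is injective on residues modulo m' when
-- n' is coprime to m' (ordered form; the general form follows by symmetry).
affine-injective-≤ : ∀ m' n' j .{{_ : NonZero m'}} → Coprime m' n' → ∀ {a b} → a ≤ b → b < m' →
  (a * n' + j) % m' ≡ (b * n' + j) % m' → a ≡ b
affine-injective-≤ m' n' j cop {a} {b} a≤b b<m' eq =
  trans (sym (+-identityʳ a)) (trans (cong (a +_) (sym d≡0)) (m+[n∸m]≡n a≤b))
  where
  d : ℕ
  d = b ∸ a
  shift : b * n' + j ≡ (a * n' + j) + d * n'
  shift = trans (cong (λ z → z * n' + j) (sym (m+[n∸m]≡n a≤b))) (expand a d n' j)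
    where
    expand : ∀ a d n' j → (a + d) * n' + j ≡ (a * n' + j) + d * n'
    expand = solve-∀
  m'∣d : m' ∣ d
  m'∣d = coprime-divisor cop (subst (m' ∣_) (*-comm d n')
           (same-residue⇒∣ m' (a * n' + j) (d * n') (trans eq (cong (_% m') shift))))
  d≡0 : d ≡ 0
  d≡0 with d | m'∣d | ≤-<-trans (m∸n≤m b a) b<m'
  ... | zero  | _   | _   = refl
  ... | suc _ | m'∣ | d<m' = ⊥-elim (<-irrefl refl (<-≤-trans d<m' (∣⇒≤ m'∣)))

affine-injective : ∀ m' n' j .{{_ : NonZero m'}} → Coprime m' n' → ∀ {a b} → a < m' → b < m' →
  (a * n' + j) % m' ≡ (b * n' + j) % m' → a ≡ b
affine-injective m' n' j cop {a} {b} a<m' b<m' eq with ≤-total a b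
... | inj₁ a≤b = affine-injective-≤ m' n' j cop a≤b b<m' eq
... | inj₂ b≤a = sym (affine-injective-≤ m' n' j cop b≤a a<m' (sym eq))

injective⇒surjective : ∀ {k} (π : Fin k → Fin k) → Injective _≡_ _≡_ π → ∀ i → ∃ λ t → π t ≡ i
injective⇒surjective {k} π inj i with any? (λ t → π t ≟ᶠ i)
... | yes hit = hit
injective⇒surjective {suc k} π inj i | no miss = ⊥-elim (<-irrefl refl (injective⇒≤ {f = squeeze} squeeze-inj))
  where
  avoids : ∀ t → i ≢ π t
  avoids t eq = miss (t , sym eq)
  -- π misses i, so it factors injectively through Fin k.
  squeeze : Fin (suc k) → Fin k
  squeeze t = punchOut (avoids t)
  squeeze-inj : Injective _≡_ _≡_ squeeze
  squeeze-inj eq = inj (punchOut-injective (avoids _) (avoids _) eq)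

-- For coprime m', n' the numbers t·n' + j (t < m') run through all residues
-- modulo m', so an m'-periodic F has the same sum along them as over [0, m').
sumTo-affine : ∀ m' n' j .{{_ : NonZero m'}} → Coprime m' n' → {F : ℕ → ℕ} → Periodic m' F →
  sumTo m' (λ t → F (t * n' + j)) ≡ sumTo m' F
sumTo-affine m' n' j cop {F} per = begin
  sumTo m' (λ t → F (t * n' + j))       ≡⟨ sumTo-cong m' (λ t _ → reduce (t * n' + j)) ⟩
  sum {m'} (λ t → F (toℕ (π t)))        ≡⟨ ∑-permute {m'} (λ i → F (toℕ i)) perm ⟨
  sumTo m' F                            ∎
  where
  open ≡-Reasoning
  reduce : ∀ x → F x ≡ F (toℕ (x mod m'))
  reduce x = trans (periodic-mod per x) (cong F (sym (toℕ-fromℕ< _)))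
  π : Fin m' → Fin m'
  π t = (toℕ t * n' + j) mod m'
  π-inj : Injective _≡_ _≡_ π
  π-inj {s} {t} eq = toℕ-injective (affine-injective m' n' j cop (toℕ<n s) (toℕ<n t)
    (trans (sym (toℕ-fromℕ< _)) (trans (cong toℕ eq) (toℕ-fromℕ< _))))
  perm : Permutation m' m'
  perm = permutation π (λ i → proj₁ (injective⇒surjective π π-inj i))
    (λ i → proj₂ (injective⇒surjective π π-inj i))
    (λ t → π-inj (proj₂ (injective⇒surjective π π-inj (π t))))

crt-product : ∀ m' n' .{{_ : NonZero m'}} .{{_ : NonZero n'}} → Coprime m' n' →
  {F G : ℕ → ℕ} → Periodic m' F → Periodic n' G →
  sumTo (m' * n') (λ y → F y * G y) ≡ sumTo m' F * sumTo n' G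
crt-product m' n' cop {F} {G} perF perG = begin
  sumTo (m' * n') (λ y → F y * G y)                          ≡⟨ sumTo-byResidue m' n' (λ y → F y * G y) ⟩
  sumTo n' (λ j → sumTo m' (λ t → F (t * n' + j) * G (t * n' + j)))
    ≡⟨ sumTo-cong n' (λ j _ → sumTo-cong m' (λ t _ → cong (F (t * n' + j) *_) (G-const t j))) ⟩
  sumTo n' (λ j → sumTo m' (λ t → F (t * n' + j) * G j))
    ≡⟨ sumTo-cong n' (λ j _ → trans (sumTo-*ʳ m' (G j) (λ t → F (t * n' + j))) (cong (_* G j) (sumTo-affine m' n' j cop perF))) ⟩
  sumTo n' (λ j → sumTo m' F * G j)                          ≡⟨ sumTo-*ˡ n' (sumTo m' F) G ⟩
  sumTo m' F * sumTo n' G                                    ∎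
  where
  open ≡-Reasoning
  G-const : ∀ t j → G (t * n' + j) ≡ G j
  G-const t j = trans (cong G (+-comm (t * n') j)) (perG j t)

-- Counting by residue classes modulo g

-- For N = K·g, classCount K g 𝒜 c is the number of elements of 𝒜 ⊆ ℤ/N that
-- are congruent to c modulo g, namely those of the form y·g + c with y < K.
classCount : ∀ {N} .{{_ : NonZero N}} → ℕ → ℕ → Subset N → ℕ → ℕ
classCount K g 𝒜 c = sumTo K (λ y → χ 𝒜 (y * g + c))

classCount≤ : ∀ {N} .{{_ : NonZero N}} K g (𝒜 : Subset N) c → classCount K g 𝒜 c ≤ K
classCount≤ K g 𝒜 c = begin
  classCount K g 𝒜 c   ≤⟨ sumTo-mono K (λ y _ → ind≤1 (does (((y * g + c) mod _) ∈? 𝒜))) ⟩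
  sumTo K (λ _ → 1)    ≡⟨ sumTo-const K 1 ⟩
  K * 1                ≡⟨ *-identityʳ K ⟩
  K                    ∎
  where open ≤-Reasoning

size-byClass : ∀ {N} .{{_ : NonZero N}} K g → N ≡ K * g → (𝒜 : Subset N) →
  ∣ 𝒜 ∣ ≡ sumTo g (classCount K g 𝒜)
size-byClass {N} K g N≡Kg 𝒜 = begin
  ∣ 𝒜 ∣                     ≡⟨ size-sumTo N 𝒜 ⟩
  sumTo N (χ 𝒜)             ≡⟨ cong (λ M → sumTo M (χ 𝒜)) N≡Kg ⟩
  sumTo (K * g) (χ 𝒜)       ≡⟨ sumTo-byResidue K g (χ 𝒜) ⟩
  sumTo g (classCount K g 𝒜) ∎
  where open ≡-Reasoning

-- The number of joint solutions modulo m'n'g is Σ_c α c · β c: on the class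
-- c mod g, the conditions on y are m'- and n'-periodic, so the CRT applies.
h-byClass : ∀ m₀ n₀ (𝒜 : Subset (suc m₀)) (ℬ : Subset (suc n₀)) g m' n'
  .{{_ : NonZero m'}} .{{_ : NonZero n'}} → Coprime m' n' →
  suc m₀ ≡ m' * g → suc n₀ ≡ n' * g →
  h m₀ n₀ (m' * n' * g) 𝒜 ℬ ≡ sumTo g (λ c → classCount m' g 𝒜 c * classCount n' g ℬ c)
h-byClass m₀ n₀ 𝒜 ℬ g m' n' cop m≡m'g n≡n'g = begin
  h m₀ n₀ (m' * n' * g) 𝒜 ℬ
    ≡⟨ h-sumTo m₀ n₀ (m' * n' * g) 𝒜 ℬ ⟩
  sumTo (m' * n' * g) (λ k → χ 𝒜 k * χ ℬ k)
    ≡⟨ sumTo-byResidue (m' * n') g (λ k → χ 𝒜 k * χ ℬ k) ⟩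
  sumTo g (λ c → sumTo (m' * n') (λ y → χ 𝒜 (y * g + c) * χ ℬ (y * g + c)))
    ≡⟨ sumTo-cong g (λ c _ → crt-product m' n' cop (class-periodic m' g 𝒜-periodic c)
                                                   (class-periodic n' g ℬ-periodic c)) ⟩
  sumTo g (λ c → classCount m' g 𝒜 c * classCount n' g ℬ c) ∎
  where
  open ≡-Reasoning
  𝒜-periodic : Periodic (m' * g) (χ 𝒜)
  𝒜-periodic = subst (λ p → Periodic p (χ 𝒜)) m≡m'g (χ-periodic 𝒜)
  ℬ-periodic : Periodic (n' * g) (χ ℬ)
  ℬ-periodic = subst (λ p → Periodic p (χ ℬ)) n≡n'g (χ-periodic ℬ)

-- Lower bounds for Σ_c α c · β c when 0 ≤ α c ≤ m' and 0 ≤ β c ≤ n'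

-- Expanded form of (m' − α)(n' − β) ≥ 0.
product-lower : ∀ {α β m' n'} → α ≤ m' → β ≤ n' → α * n' + β * m' ≤ α * β + m' * n'
product-lower {α} {β} α≤m' β≤n' =
  subst₂ (λ M N → α * N + β * M ≤ α * β + M * N) (m+[n∸m]≡n α≤m') (m+[n∸m]≡n β≤n')
    (expanded α β _ _)
  where
  expanded : ∀ α β a b → α * (β + b) + β * (α + a) ≤ α * β + (α + a) * (β + b)
  expanded α β a b = subst (α * (β + b) + β * (α + a) ≤_) (identity α β a b) (m≤m+n _ (a * b))
    where
    identity : ∀ α β a b → α * (β + b) + β * (α + a) + a * b ≡ α * β + (α + a) * (β + b)
    identity = solve-∀

sum-product-lower : ∀ g {m' n'} (α β : ℕ → ℕ) →
  (∀ c → c < g → α c ≤ m') → (∀ c → c < g → β c ≤ n') →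
  sumTo g α * n' + sumTo g β * m' ≤ sumTo g (λ c → α c * β c) + g * (m' * n')
sum-product-lower g {m'} {n'} α β α≤ β≤ = begin
  sumTo g α * n' + sumTo g β * m'
    ≡⟨ cong₂ _+_ (sumTo-*ʳ g n' α) (sumTo-*ʳ g m' β) ⟨
  sumTo g (λ c → α c * n') + sumTo g (λ c → β c * m')
    ≡⟨ sumTo-+ g (λ c → α c * n') (λ c → β c * m') ⟨
  sumTo g (λ c → α c * n' + β c * m')
    ≤⟨ sumTo-mono g (λ c c<g → product-lower (α≤ c c<g) (β≤ c c<g)) ⟩
  sumTo g (λ c → α c * β c + m' * n')
    ≡⟨ sumTo-+ g (λ c → α c * β c) (λ _ → m' * n') ⟩
  sumTo g (λ c → α c * β c) + sumTo g (λ _ → m' * n')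
    ≡⟨ cong (sumTo g (λ c → α c * β c) +_) (sumTo-const g (m' * n')) ⟩
  sumTo g (λ c → α c * β c) + g * (m' * n')
    ∎
  where open ≤-Reasoning

-- Truncating α at r costs at most n' per missing unit: r·β ≤ α·β + n'·(r ∸ α).
truncated-product : ∀ α β r n' → β ≤ n' → r * β ≤ α * β + n' * (r ∸ α)
truncated-product α β r n' β≤n' with r ≤? α
... | yes r≤α = ≤-trans (*-monoˡ-≤ β r≤α) (m≤m+n (α * β) _)
... | no  r≰α = begin
  r * β                      ≡⟨ cong (_* β) (m+[n∸m]≡n α≤r) ⟨
  (α + (r ∸ α)) * β          ≡⟨ *-distribʳ-+ β α (r ∸ α) ⟩
  α * β + (r ∸ α) * β        ≤⟨ +-monoʳ-≤ (α * β) (*-monoʳ-≤ (r ∸ α) β≤n') ⟩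
  α * β + (r ∸ α) * n'       ≡⟨ cong (α * β +_) (*-comm (r ∸ α) n') ⟩
  α * β + n' * (r ∸ α)       ∎
  where
  open ≤-Reasoning
  α≤r : α ≤ r
  α≤r = <⇒≤ (≰⇒> r≰α)

deficient : ℕ → ℕ → ℕ
deficient r α with α <? r
... | yes _ = 1
... | no  _ = 0

shortfall≤ : ∀ r α → r ∸ α ≤ deficient r α * r
shortfall≤ r α with α <? r
... | yes _   = ≤-trans (m∸n≤m r α) (≤-reflexive (sym (+-identityʳ r)))
... | no  α≮r = ≤-reflexive (m≤n⇒m∸n≡0 (≮⇒≥ α≮r))

shortfall-balance : ∀ r α m' → α ≤ m' →
  (r ∸ α) + α + deficient r α * m' ≤ deficient r α * r + m'
shortfall-balance r α m' α≤m' with α <? r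
... | yes α<r = ≤-reflexive (balanced (m∸n+n≡m (<⇒≤ α<r)))
  where
  balanced : r ∸ α + α ≡ r → r ∸ α + α + 1 * m' ≡ 1 * r + m'
  balanced eq = trans (cong (_+ 1 * m') eq) (cong₂ _+_ (sym (*-identityˡ r)) (*-identityˡ m'))
... | no  α≮r = begin
  r ∸ α + α + 0   ≡⟨ +-identityʳ _ ⟩
  r ∸ α + α       ≡⟨ cong (_+ α) (m≤n⇒m∸n≡0 (≮⇒≥ α≮r)) ⟩
  α               ≤⟨ α≤m' ⟩
  m'              ∎
  where open ≤-Reasoning

-- The arithmetic behind the deficit bound, with D the total shortfall and J the
-- number of deficient classes.  If J ≤ B then D ≤ J·r ≤ B·r.  Otherwise write
-- J = B + 1 + t; the balance inequality then reads D + t·m' ≤ B·r + t·r, and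
-- t·r ≤ t·m' since r ≤ m'.
deficit-arith : ∀ D J A B r m' → r ≤ m' → D ≤ J * r →
  D + (A * m' + r) + J * m' ≤ J * r + (A + B + 1) * m' → D ≤ B * r
deficit-arith D J A B r m' r≤m' D≤Jr balance with J ≤? B
... | yes J≤B = ≤-trans D≤Jr (*-monoˡ-≤ r J≤B)
... | no  J≰B = +-cancelʳ-≤ (t * m') D (B * r)
                  (≤-trans cancelled (+-monoʳ-≤ (B * r) (*-monoʳ-≤ t r≤m')))
  where
  t : ℕ
  t = J ∸ suc B
  J≡ : J ≡ suc B + t
  J≡ = sym (m+[n∸m]≡n (≰⇒> J≰B))
  lhs : ∀ D A B r m' t → D + (A * m' + r) + (suc B + t) * m' ≡ (D + t * m') + (r + (A + B + 1) * m')
  lhs = solve-∀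
  rhs : ∀ A B r m' t → (suc B + t) * r + (A + B + 1) * m' ≡ (B * r + t * r) + (r + (A + B + 1) * m')
  rhs = solve-∀
  cancelled : D + t * m' ≤ B * r + t * r
  cancelled = +-cancelʳ-≤ (r + (A + B + 1) * m') _ _
    (subst₂ _≤_ (trans (cong (λ z → D + (A * m' + r) + z * m') J≡) (lhs D A B r m' t))
                (trans (cong (λ z → z * r + (A + B + 1) * m') J≡) (rhs A B r m' t)) balance)

deficit-bound : ∀ g m' A B r (α : ℕ → ℕ) → (∀ c → c < g → α c ≤ m') → r ≤ m' →
  sumTo g α ≡ A * m' + r → A + B + 1 ≡ g → sumTo g (λ c → r ∸ α c) ≤ B * r
deficit-bound g m' A B r α α≤ r≤m' Σα≡ g≡ = deficit-arith D J A B r m' r≤m' D≤Jr balance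
  where
  D J : ℕ
  D = sumTo g (λ c → r ∸ α c)
  J = sumTo g (λ c → deficient r (α c))
  D≤Jr : D ≤ J * r
  D≤Jr = ≤-trans (sumTo-mono g (λ c _ → shortfall≤ r (α c)))
                 (≤-reflexive (sumTo-*ʳ g r (λ c → deficient r (α c))))
  summed : D + sumTo g α + J * m' ≤ J * r + g * m'
  summed = subst₂ _≤_
    (trans (sumTo-+ g (λ c → r ∸ α c + α c) (λ c → deficient r (α c) * m'))
      (cong₂ _+_ (sumTo-+ g (λ c → r ∸ α c) α) (sumTo-*ʳ g m' (λ c → deficient r (α c)))))
    (trans (sumTo-+ g (λ c → deficient r (α c) * r) (λ _ → m'))
      (cong₂ _+_ (sumTo-*ʳ g r (λ c → deficient r (α c))) (sumTo-const g m')))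
    (sumTo-mono g (λ c c<g → shortfall-balance r (α c) m' (α≤ c c<g)))
  balance : D + (A * m' + r) + J * m' ≤ J * r + (A + B + 1) * m'
  balance = subst₂ _≤_ (cong (λ s → D + s + J * m') Σα≡) (cong (λ s → J * r + s * m') (sym g≡)) summed

corner-bound : ∀ g m' n' A B r rB (α β : ℕ → ℕ) →
  (∀ c → c < g → α c ≤ m') → (∀ c → c < g → β c ≤ n') → r ≤ m' →
  sumTo g α ≡ A * m' + r → sumTo g β ≡ B * n' + rB → A + B + 1 ≡ g →
  r * rB ≤ sumTo g (λ c → α c * β c)
corner-bound g m' n' A B r rB α β α≤ β≤ r≤m' Σα≡ Σβ≡ g≡ =
  +-cancelˡ-≤ (r * (B * n')) _ _ (begin
    r * (B * n') + r * rB          ≡⟨ *-distribˡ-+ r (B * n') rB ⟨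
    r * (B * n' + rB)              ≡⟨ cong (r *_) Σβ≡ ⟨
    r * sumTo g β                  ≤⟨ truncated ⟩
    X + n' * D                     ≤⟨ +-monoʳ-≤ X (*-monoʳ-≤ n' (deficit-bound g m' A B r α α≤ r≤m' Σα≡ g≡)) ⟩
    X + n' * (B * r)               ≡⟨ rearrange X n' B r ⟩
    r * (B * n') + X               ∎)
  where
  open ≤-Reasoning
  X D : ℕ
  X = sumTo g (λ c → α c * β c)
  D = sumTo g (λ c → r ∸ α c)
  truncated : r * sumTo g β ≤ X + n' * D
  truncated = subst₂ _≤_ (sumTo-*ˡ g r β)
    (trans (sumTo-+ g (λ c → α c * β c) (λ c → n' * (r ∸ α c)))
           (cong (X +_) (sumTo-*ˡ g n' (λ c → r ∸ α c))))
    (sumTo-mono g (λ c c<g → truncated-product (α c) (β c) r n' (β≤ c c<g)))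
  rearrange : ∀ X n' B r → X + n' * (B * r) ≡ r * (B * n') + X
  rearrange = solve-∀

generic-arith : ∀ X g m' n' A rA B rB → g ≤ A + B →
  (A * m' + rA) * n' + (B * n' + rB) * m' ≤ X + g * (m' * n') →
  (A + B ∸ g) * (m' * n') + rA * n' + rB * m' ≤ X
generic-arith X g m' n' A rA B rB g≤A+B bound =
  +-cancelʳ-≤ (g * (m' * n')) _ X (subst (_≤ X + g * (m' * n')) regroup bound)
  where
  d : ℕ
  d = A + B ∸ g
  expand : ∀ A B m' n' rA rB →
    (A * m' + rA) * n' + (B * n' + rB) * m' ≡ (A + B) * (m' * n') + rA * n' + rB * m'
  expand = solve-∀
  split : ∀ g d m' n' rA rB →
    (g + d) * (m' * n') + rA * n' + rB * m' ≡ d * (m' * n') + rA * n' + rB * m' + g * (m' * n')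
  split = solve-∀
  regroup : (A * m' + rA) * n' + (B * n' + rB) * m' ≡ d * (m' * n') + rA * n' + rB * m' + g * (m' * n')
  regroup = trans (expand A B m' n' rA rB)
    (trans (cong (λ s → s * (m' * n') + rA * n' + rB * m') (sym (m+[n∸m]≡n g≤A+B)))
           (split g d m' n' rA rB))

factors-nonZero : ∀ {k a b} → suc k ≡ a * b → NonZero a × NonZero b
factors-nonZero {a = a} {b} e = m*n≢0⇒m≢0 a , m*n≢0⇒n≢0 a
  where
  instance
    a*b≢0 : NonZero (a * b)
    a*b≢0 = subst NonZero e _

coprime-cofactors : ∀ {m n g m' n'} .{{_ : NonZero g}} →
  g ≡ gcd m n → m ≡ m' * g → n ≡ n' * g → Coprime m' n'
coprime-cofactors {m} {n} {g} g≡ m≡ n≡ = GCD≡1⇒coprime (GCD-* (subst₂ (λ a b → GCD a b (1 * g)) m≡ n≡ gcd-is))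
  where
  gcd-is : GCD m n (1 * g)
  gcd-is = subst (GCD m n) (trans (sym g≡) (sym (*-identityˡ g))) (gcd-GCD m n)

theorem2p1 : (m₀ n₀ : ℕ) (𝒜 : Subset (suc m₀)) (ℬ : Subset (suc n₀))
    (g m' n' A rA B rB : ℕ) →
    g ≡ gcd (suc m₀) (suc n₀) →
    suc m₀ ≡ m' * g → suc n₀ ≡ n' * g →
    ∣ 𝒜 ∣ ≡ A * m' + rA → rA < m' →
    ∣ ℬ ∣ ≡ B * n' + rB → rB < n' →
    (A + B + 1 < g → 0 ≤ h m₀ n₀ (m' * n' * g) 𝒜 ℬ) ×
    (A + B + 1 ≡ g → rA * rB ≤ h m₀ n₀ (m' * n' * g) 𝒜 ℬ) ×
    (g ≤ A + B →
    (A + B ∸ g) * (m' * n') + rA * n' + rB * m' ≤ h m₀ n₀ (m' * n' * g) 𝒜 ℬ)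
theorem2p1 m₀ n₀ 𝒜 ℬ g m' n' A rA B rB g≡ m≡ n≡ |𝒜|≡ rA<m' |ℬ|≡ _ =
  (λ _ → z≤n) ,
  (λ g≡A+B+1 → subst (rA * rB ≤_) (sym h≡)
     (corner-bound g m' n' A B rA rB α β α≤ β≤ (<⇒≤ rA<m') Σα Σβ g≡A+B+1)) ,
  (λ g≤A+B → subst ((A + B ∸ g) * (m' * n') + rA * n' + rB * m' ≤_) (sym h≡)
     (generic-arith X g m' n' A rA B rB g≤A+B
       (subst (λ s → s ≤ X + g * (m' * n')) (cong₂ (λ a b → a * n' + b * m') Σα Σβ)
         (sum-product-lower g α β α≤ β≤))))
  where
  instance
    m'≢0 : NonZero m'
    m'≢0 = proj₁ (factors-nonZero {a = m'} m≡)
    n'≢0 : NonZero n'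
    n'≢0 = proj₁ (factors-nonZero {a = n'} n≡)
    g≢0 : NonZero g
    g≢0 = proj₂ (factors-nonZero {a = m'} m≡)
  α β : ℕ → ℕ
  α = classCount m' g 𝒜
  β = classCount n' g ℬ
  α≤ : ∀ c → c < g → α c ≤ m'
  α≤ c _ = classCount≤ m' g 𝒜 c
  β≤ : ∀ c → c < g → β c ≤ n'
  β≤ c _ = classCount≤ n' g ℬ c
  Σα : sumTo g α ≡ A * m' + rA
  Σα = trans (sym (size-byClass m' g m≡ 𝒜)) |𝒜|≡
  Σβ : sumTo g β ≡ B * n' + rB
  Σβ = trans (sym (size-byClass n' g n≡ ℬ)) |ℬ|≡
  X : ℕ
  X = sumTo g (λ c → α c * β c)
  h≡ : h m₀ n₀ (m' * n' * g) 𝒜 ℬ ≡ X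
  h≡ = h-byClass m₀ n₀ 𝒜 ℬ g m' n' (coprime-cofactors g≡ m≡ n≡) m≡ n≡
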